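{- Let $k \ge 1$ be an integer, $p = 2k^2+2k+1$, and let $\phi_k : \mathbb{Z}^2 \to \mathbb{Z}_p$ be the map $\phi_k(i,j) = \overline{(k+1)i + kj}$. For any integers $m,n \ge 1$ there exists $\bar{\ell} \in \mathbb{Z}_p$ such that \[ \left| \phi_k^{ -1}(\bar{\ell}) \cap Y_{m+2k,n+2k} \right| \le \left\lfloor \frac{(m+2k)(n+2k)}{p} \right\rfloor, \] where $Y_{m+2k,n+2k} = \{(i,j) \in \mathbb{Z}^2 : -k \le i \le m+k-1,\ -k \le j \le n+k-1\}$. -}

module Defs where

open import Data.Nat as ℕ using (ℕ; suc; _*_; _+_)
open import Data.Integer as ℤ using (ℤ; +_)
open import Data.Integer.DivMod using (_modℕ_; n%ℕd<d)
open import Data.Fin as Fin using (Fin; fromℕ<)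
open import Data.Fin.Properties using () renaming (_≟_ to _≟ᶠ_)
open import Data.List using (List; []; _∷_; map; concatMap; length; filter; upTo)
open import Data.Product using (_×_; _,_)

pOf : ℕ → ℕ
pOf k = suc (2 * k * k + 2 * k)

φ : (k : ℕ) → ℤ × ℤ → Fin (pOf k)
φ k (i , j) =
  fromℕ< (n%ℕd<d ((+ (suc k)) ℤ.* i ℤ.+ (+ k) ℤ.* j) (pOf k))

range : ℤ → ℕ → List ℤ
range a len = map (λ t → a ℤ.+ + t) (upTo len)

-- Y_{M,N} = {(i,j) ∈ ℤ² : -k ≤ i ≤ M-k-1, -k ≤ j ≤ N-k-1}, listed without repetition.
-- With M = m + 2k, N = n + 2k this is -k ≤ i ≤ m+k-1, -k ≤ j ≤ n+k-1.
Y : (k M N : ℕ) → List (ℤ × ℤ)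
Y k M N = concatMap (λ i → map (λ j → (i , j)) (range (ℤ.- (+ k)) N)) (range (ℤ.- (+ k)) M)

-- | φ_k⁻¹(ℓ) ∩ Y_{M,N} |  (Y is duplicate-free, so this is the cardinality)
fiberCount : (k M N : ℕ) → Fin (pOf k) → ℕ
fiberCount k M N ℓ = length (filter (λ x → φ k x ≟ᶠ ℓ) (Y k M N))

-- Pigeonhole: the p fibers of φ_k partition Y, which has (m+2k)(n+2k) points, so if every
-- fiber had more than ⌊(m+2k)(n+2k)/p⌋ points, Y would have at least p·(⌊…⌋ + 1) > |Y| points.
-- This averaging argument needs none of the positivity hypotheses.
module Submission where

open import Defs
open import Data.Nat using (ℕ; _≤_; _+_; _*_; _/_)
open import Data.Fin using (Fin)
open import Data.Product using (∃)

open import Data.Nat using (zero; suc; NonZero; z≤n; _≤?_)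
open import Data.Nat.Properties using (+-*-semiring; +-mono-≤; *-comm; ≰⇒>; n≮n)
open import Data.Nat.DivMod using (/-monoˡ-≤; m*n/n≡m)
open import Data.Fin using (zero; suc)
open import Data.Fin.Properties using (_≟_; any?)
open import Data.Vec.Functional using (Vector)
open import Data.List using (List; []; _∷_; map; concatMap; filter; length; upTo; _++_)
open import Data.List.Properties using (length-map; length-++; length-upTo)
open import Data.Integer using (-_; +_)
open import Data.Bool using (if_then_else_)
open import Data.Product using (_,_)
open import Relation.Nullary using (yes; no; does; contradiction)
open import Relation.Binary.PropositionalEquality using (_≡_; refl; cong; cong₂; subst; subst₂; trans)
open Relation.Binary.PropositionalEquality.≡-Reasoning
open import Algebra.Properties.Semiring.Sum +-*-semiring using (sum; ∑-distrib-+; sum-cong-≗; sum-replicate-zero)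

*≤sum : ∀ {n} c (f : Vector ℕ n) → (∀ i → c ≤ f i) → n * c ≤ sum f
*≤sum {zero}  c f c≤f = z≤n
*≤sum {suc n} c f c≤f = +-mono-≤ (c≤f zero) (*≤sum c (λ i → f (suc i)) (λ i → c≤f (suc i)))

δ : ∀ {n} → Fin n → Vector ℕ n
δ t ℓ = if does (t ≟ ℓ) then 1 else 0

sum-δ : ∀ {n} (t : Fin n) → sum (δ t) ≡ 1
sum-δ {suc n} zero    = cong suc (sum-replicate-zero n)
sum-δ {suc n} (suc t) = sum-δ t

fiberSize : ∀ {A : Set} {n} → (A → Fin n) → List A → Vector ℕ n
fiberSize f xs ℓ = length (filter (λ x → f x ≟ ℓ) xs)

fiberSize-∷ : ∀ {A : Set} {n} (f : A → Fin n) x xs ℓ →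
  fiberSize f (x ∷ xs) ℓ ≡ δ (f x) ℓ + fiberSize f xs ℓ
fiberSize-∷ f x xs ℓ with f x ≟ ℓ
... | yes _ = refl
... | no _  = refl

sum-fiberSize : ∀ {A : Set} {n} (f : A → Fin n) xs → sum (fiberSize f xs) ≡ length xs
sum-fiberSize {n = n} f []       = sum-replicate-zero n
sum-fiberSize         f (x ∷ xs) = begin
  sum (fiberSize f (x ∷ xs))                   ≡⟨ sum-cong-≗ (fiberSize-∷ f x xs) ⟩
  sum (λ ℓ → δ (f x) ℓ + fiberSize f xs ℓ)     ≡⟨ ∑-distrib-+ (δ (f x)) (fiberSize f xs) ⟩
  sum (δ (f x)) + sum (fiberSize f xs)         ≡⟨ cong₂ _+_ (sum-δ (f x)) (sum-fiberSize f xs) ⟩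
  suc (length xs)                              ∎

∃-small-fiber : ∀ {A : Set} {n} .{{_ : NonZero n}} (f : A → Fin n) (xs : List A) →
  ∃ λ ℓ → fiberSize f xs ℓ ≤ length xs / n
∃-small-fiber {n = n} f xs with any? (λ ℓ → fiberSize f xs ℓ ≤? length xs / n)
... | yes small = small
... | no  none  =
  contradiction (subst (_≤ length xs / n) (m*n/n≡m q+1 n) (/-monoˡ-≤ n all-large)) (n≮n _)
  where
  q+1 = suc (length xs / n)
  all-large : q+1 * n ≤ length xs
  all-large = subst₂ _≤_ (*-comm n q+1) (sum-fiberSize f xs)
                (*≤sum q+1 (fiberSize f xs) (λ ℓ → ≰⇒> (λ le → none (ℓ , le))))

length-concatMap-map : ∀ {A B C : Set} (g : A → B → C) xs ys →
  length (concatMap (λ x → map (g x) ys) xs) ≡ length xs * length ys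
length-concatMap-map g []       ys = refl
length-concatMap-map g (x ∷ xs) ys = begin
  length (map (g x) ys ++ concatMap (λ x → map (g x) ys) xs)          ≡⟨ length-++ (map (g x) ys) ⟩
  length (map (g x) ys) + length (concatMap (λ x → map (g x) ys) xs)  ≡⟨ cong₂ _+_ (length-map (g x) ys) (length-concatMap-map g xs ys) ⟩
  length ys + length xs * length ys                                    ∎

length-range : ∀ a len → length (range a len) ≡ len
length-range a len = trans (length-map _ (upTo len)) (length-upTo len)

length-Y : ∀ k M N → length (Y k M N) ≡ M * N
length-Y k M N =
  trans (length-concatMap-map _,_ (range -k M) (range -k N)) (cong₂ _*_ (length-range -k M) (length-range -k N))
  where -k = - + k

corollary3p4 : (k : ℕ) → 1 ≤ k → (m n : ℕ) → 1 ≤ m → 1 ≤ n →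
    ∃ λ (ℓ : Fin (pOf k)) →
      fiberCount k (m + 2 * k) (n + 2 * k) ℓ ≤ ((m + 2 * k) * (n + 2 * k)) / pOf k
corollary3p4 k _ m n _ _ =
  subst (λ L → ∃ λ ℓ → fiberCount k M N ℓ ≤ L / pOf k) (length-Y k M N) (∃-small-fiber (φ k) (Y k M N))
  where
  M = m + 2 * k
  N = n + 2 * k
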